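{- Let $k$ be a natural number, let $M_{(k)}$ and $N_{(k)}$ be canonical terms of observation depth $k$, let $x$ be a variable, and let $\tau$ be a simple type. If the hereditary substitution $[N_{(k)}/x]^\tau M_{(k)}$ is defined, then it is a canonical term of observation depth $k$.
   Context: Constants $c$ form an infinite set disjoint from variables; binders are never constants and constants are unaffected by substitution. Terms are possibly infinite trees in head-spine form: $h\cdot(M_1;\dots;M_n)$ is a head $h$ (variable or constant) applied to finitely many arguments; $\operatorname{()}$ is the empty spine. Observation depth: for each $k$, canonical terms $M_{(k)}$, neutral terms $R_{(k)}$, continuing spines $T_{(k)}$ and suspended spines $S_{(k)}$ of depth $k$ are defined by: at depth $0$ every tree is admitted; at depth $k+1$ they are generated inductively (finite derivations) by $M_{(k+1)} ::= \lambda x.\, M_{(k+1)} \mid R_{(k+1)}$; $R_{(k+1)} ::= x\cdot T_{(k+1)} \mid c\cdot S_{(k+1)}$; $T_{(k+1)} ::= \operatorname{()} \mid M_{(k+1)}; T_{(k+1)}$; $S_{(k+1)} ::= \operatorname{()} \mid M_{(k)}; S_{(k+1)}$. A term of depth $k+1$ may be regarded as a term of depth $k$ (observing only its first $k$ observations). Two trees are equal up to depth $k$ ($=_{(k)}$): everything is equal at depth $0$, and at depth $k+1$ equality is structural, comparing arguments of constant heads up to depth $k$ and all other subterms up to depth $k+1$. Simple types: $\tau ::= * \mid \tau_1\to\tau_2$ (finite). Hereditary substitution $[N/x]^\tau$ is a partial operation defined by lexicographic induction on $\tau$, then the depth $k$, then the structure of the term substituted into; when no clause applies the result is undefined, and results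 at depth $k$ are determined up to $=_{(k)}$ (at depth $0$ every result is acceptable). The clauses at depth $k+1$ (with $N$ of depth $k+1$) are: canonical terms: $[N/x]^\tau(\lambda y.\, M) = \lambda y.\, M'$ if $[N/x]^\tau M = M'$ (bound variables renamed apart); $[N/x]^\tau R$ as for neutral terms; neutral terms: $[N/x]^\tau(x\cdot T) = N'$ if $[N/x]^\tau T = T'$ and $T'\rhd^\tau N = N'$; $[N/x]^\tau(y\cdot T) = y\cdot T'$ for a variable $y\neq x$ if $[N/x]^\tau T = T'$; $[N/x]^\tau(c\cdot S) = c\cdot S'$ if $[N/x]^\tau S = S'$, where here $N$ is regarded as a term of depth $k$ and the suspended-spine clause is used; continuing spines: $[N/x]^\tau \operatorname{()} = \operatorname{()}$; $[N/x]^\tau (M;T) = M';T'$ if $[N/x]^\tau M = M'$ and $[N/x]^\tau T = T'$; spine application: $\operatorname{()} \rhd^{*} R = R$; $(N_1;T)\rhd^{\tau_2\to\tau_1} \lambda y.\, M = M''$ if $[N_1/y]^{\tau_2} M = M'$ and $T\rhd^{\tau_1} M' = M''$; suspended spines (with $N$ of depth $k$ and $S$ of depth $k+1$): $[N/x]^\tau\operatorname{()} = \operatorname{()}$; $[N/x]^\tau (M;S) = M';S'$ if $[N/x]^\tau M = M'$ (at depth $k$) and $[N/x]^\tau S = S'$. -}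

module Defs where

open import Data.Nat using (ℕ; zero; suc)
open import Data.List using (List; []; _∷_)
open import Data.List.Relation.Unary.Any using (Any)
open import Relation.Binary.PropositionalEquality using (_≡_; _≢_)
open import Relation.Nullary using (¬_)

Var : Set
Var = ℕ

Const : Set
Const = ℕ

data Head : Set where
  var : Var → Head
  con : Const → Head

-- Possibly infinite trees in head-spine form.  A node is either a
-- lambda  ƛ x M  or a head applied to a finite spine  h · (M₁; …; Mₙ).

mutual
  record Tm : Set where
    coinductive
    field out : Node

  data Node : Set where
    ƛ   : Var → Tm → Node
    _·_ : Head → List Tm → Node

open Tm public

Spine : Set
Spine = List Tm

data Ty : Set where
  *   : Ty
  _⇒_ : Ty → Ty → Ty

mutual
  data Can : ℕ → Tm → Set where
    can0 : ∀ {M} → Can zero M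
    canλ : ∀ {k M y M₁} → out M ≡ ƛ y M₁ → Can (suc k) M₁ → Can (suc k) M
    canR : ∀ {k M} → Neu (suc k) M → Can (suc k) M

  data Neu : ℕ → Tm → Set where
    neu0 : ∀ {M} → Neu zero M
    neuV : ∀ {k M y T} → out M ≡ var y · T → CSp (suc k) T → Neu (suc k) M
    neuC : ∀ {k M c S} → out M ≡ con c · S → SSp (suc k) S → Neu (suc k) M

  data CSp : ℕ → Spine → Set where
    csp0  : ∀ {T} → CSp zero T
    cnil  : ∀ {k} → CSp (suc k) []
    ccons : ∀ {k M T} → Can (suc k) M → CSp (suc k) T → CSp (suc k) (M ∷ T)

  data SSp : ℕ → Spine → Set where
    ssp0  : ∀ {S} → SSp zero S
    snil  : ∀ {k} → SSp (suc k) []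
    scons : ∀ {k M S} → Can k M → SSp (suc k) S → SSp (suc k) (M ∷ S)

-- Free variables (an occurrence is a finite path, hence inductive).

data _∈FV_ (y : Var) : Tm → Set where
  fv-lam  : ∀ {M z M₁} → out M ≡ ƛ z M₁ → y ≢ z → y ∈FV M₁ → y ∈FV M
  fv-head : ∀ {M T} → out M ≡ var y · T → y ∈FV M
  fv-arg  : ∀ {M h T} → out M ≡ h · T → Any (y ∈FV_) T → y ∈FV M

-- Hereditary substitution, as a (partial) relation generated by the
-- clauses.  At depth 0 every result is acceptable.
--
--   Sub  τ k N x M  M'   :  [N/x]^τ M = M'      at depth k
--   SubC τ k N x T  T'   :  [N/x]^τ T = T'      (continuing spine) at depth k
--   SubS τ k N x S  S'   :  [N/x]^τ S = S'      (suspended spine of depth k;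
--                                               its arguments at depth k-1)
--   App  τ k T N N'      :  T ▷^τ N = N'        at depth k

mutual
  data Sub : Ty → ℕ → Tm → Var → Tm → Tm → Set where
    sub0 : ∀ {τ N x M M'} → Sub τ zero N x M M'
    subλ : ∀ {τ k N x M M' y M₁ M₁'} →
           out M ≡ ƛ y M₁ →
           y ≢ x → ¬ (y ∈FV N) →
           Sub τ (suc k) N x M₁ M₁' →
           out M' ≡ ƛ y M₁' →
           Sub τ (suc k) N x M M'
    subx : ∀ {τ k N x M M' T T'} →
           out M ≡ var x · T →
           SubC τ (suc k) N x T T' →
           App τ (suc k) T' N M' →
           Sub τ (suc k) N x M M'
    suby : ∀ {τ k N x M M' y T T'} →
           out M ≡ var y · T → y ≢ x →
           SubC τ (suc k) N x T T' →
           out M' ≡ var y · T' →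
           Sub τ (suc k) N x M M'
    subc : ∀ {τ k N x M M' c S S'} →
           out M ≡ con c · S →
           SubS τ (suc k) N x S S' →
           out M' ≡ con c · S' →
           Sub τ (suc k) N x M M'

  data SubC : Ty → ℕ → Tm → Var → Spine → Spine → Set where
    subC0    : ∀ {τ N x T T'} → SubC τ zero N x T T'
    subCnil  : ∀ {τ k N x} → SubC τ (suc k) N x [] []
    subCcons : ∀ {τ k N x M M' T T'} →
               Sub τ (suc k) N x M M' → SubC τ (suc k) N x T T' →
               SubC τ (suc k) N x (M ∷ T) (M' ∷ T')

  data SubS : Ty → ℕ → Tm → Var → Spine → Spine → Set where
    subS0    : ∀ {τ N x S S'} → SubS τ zero N x S S'
    subSnil  : ∀ {τ k N x} → SubS τ (suc k) N x [] []
    subScons : ∀ {τ k N x M M' S S'} →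
               Sub τ k N x M M' →
               SubS τ (suc k) N x S S' →
               SubS τ (suc k) N x (M ∷ S) (M' ∷ S')

  data App : Ty → ℕ → Spine → Tm → Tm → Set where
    app0    : ∀ {τ T N N'} → App τ zero T N N'
    appNil  : ∀ {k R h S} → out R ≡ h · S →
              App * (suc k) [] R R
    appCons : ∀ {τ₁ τ₂ k N₁ T N y M M₁ M₂} →
              out N ≡ ƛ y M →
              Sub τ₂ (suc k) N₁ y M M₁ →
              App τ₁ (suc k) T M₁ M₂ →
              App (τ₂ ⇒ τ₁) (suc k) (N₁ ∷ T) N M₂

{-# OPTIONS --safe #-}
module Submission where

open import Defs
open import Data.Nat using (ℕ; zero; suc)
open import Relation.Binary.PropositionalEquality using (_≡_; refl; sym; trans)

-- Induction on the derivation of the substitution, simultaneously for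
-- terms, both kinds of spines and spine application.  Two points need
-- care.  Under a constant head the arguments are only observed to depth
-- k-1, and there N is substituted regarded at depth k-1, so we need that
-- depth k+1 implies depth k.  In the case x · T the substituted spine is
-- applied to N, and each step of that application substitutes an argument
-- (canonical by the induction hypothesis) into the body of the λ-abstraction
-- N, which is canonical at the same depth as N.

private
  variable
    k : ℕ
    y : Var
    c : Const
    M M₁ : Tm
    h : Head
    T : Spine

Can-ƛ-body : out M ≡ ƛ y M₁ → Can (suc k) M → Can (suc k) M₁
Can-ƛ-body p (canλ q cM₁) with trans (sym q) p
... | refl = cM₁
Can-ƛ-body p (canR (neuV q _)) with trans (sym p) q
... | ()
Can-ƛ-body p (canR (neuC q _)) with trans (sym p) q
... | ()

Can-·⇒Neu : out M ≡ h · T → Can (suc k) M → Neu (suc k) M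
Can-·⇒Neu p (canλ q _) with trans (sym p) q
... | ()
Can-·⇒Neu p (canR nM) = nM

Neu-var-spine : out M ≡ var y · T → Neu (suc k) M → CSp (suc k) T
Neu-var-spine p (neuV q cT) with trans (sym q) p
... | refl = cT
Neu-var-spine p (neuC q _) with trans (sym p) q
... | ()

Neu-con-spine : out M ≡ con c · T → Neu (suc k) M → SSp (suc k) T
Neu-con-spine p (neuC q sT) with trans (sym q) p
... | refl = sT
Neu-con-spine p (neuV q _) with trans (sym p) q
... | ()

Can-var-spine : out M ≡ var y · T → Can (suc k) M → CSp (suc k) T
Can-var-spine p cM = Neu-var-spine p (Can-·⇒Neu p cM)

Can-con-spine : out M ≡ con c · T → Can (suc k) M → SSp (suc k) T
Can-con-spine p cM = Neu-con-spine p (Can-·⇒Neu p cM)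

mutual
  Can-lower : Can (suc k) M → Can k M
  Can-lower {zero}  _            = can0
  Can-lower {suc k} (canλ p cM₁) = canλ p (Can-lower cM₁)
  Can-lower {suc k} (canR nM)    = canR (Neu-lower nM)

  Neu-lower : Neu (suc (suc k)) M → Neu (suc k) M
  Neu-lower (neuV p cT) = neuV p (CSp-lower cT)
  Neu-lower (neuC p sT) = neuC p (SSp-lower sT)

  CSp-lower : CSp (suc (suc k)) T → CSp (suc k) T
  CSp-lower cnil          = cnil
  CSp-lower (ccons cM cT) = ccons (Can-lower cM) (CSp-lower cT)

  SSp-lower : SSp (suc (suc k)) T → SSp (suc k) T
  SSp-lower snil          = snil
  SSp-lower (scons cM sT) = scons (Can-lower cM) (SSp-lower sT)

mutual
  Sub-preserves-Can : ∀ {τ k N x M M'} →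
    Can k M → Can k N → Sub τ k N x M M' → Can k M'
  Sub-preserves-Can _  _  sub0 = can0
  Sub-preserves-Can cM cN (subλ p _ _ d q) =
    canλ q (Sub-preserves-Can (Can-ƛ-body p cM) cN d)
  Sub-preserves-Can cM cN (subx p dT dA) =
    App-preserves-Can (SubC-preserves-CSp (Can-var-spine p cM) cN dT) cN dA
  Sub-preserves-Can cM cN (suby p _ dT q) =
    canR (neuV q (SubC-preserves-CSp (Can-var-spine p cM) cN dT))
  Sub-preserves-Can cM cN (subc p dS q) =
    canR (neuC q (SubS-preserves-SSp (Can-con-spine p cM) (Can-lower cN) dS))

  SubC-preserves-CSp : ∀ {τ k N x T T'} →
    CSp k T → Can k N → SubC τ k N x T T' → CSp k T'
  SubC-preserves-CSp _             _  subC0           = csp0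
  SubC-preserves-CSp _             _  subCnil         = cnil
  SubC-preserves-CSp (ccons cM cT) cN (subCcons d dT) =
    ccons (Sub-preserves-Can cM cN d) (SubC-preserves-CSp cT cN dT)

  SubS-preserves-SSp : ∀ {τ k N x S S'} →
    SSp (suc k) S → Can k N → SubS τ (suc k) N x S S' → SSp (suc k) S'
  SubS-preserves-SSp _             _  subSnil         = snil
  SubS-preserves-SSp (scons cM sS) cN (subScons d dS) =
    scons (Sub-preserves-Can cM cN d) (SubS-preserves-SSp sS cN dS)

  App-preserves-Can : ∀ {τ k T N N'} →
    CSp k T → Can k N → App τ k T N N' → Can k N'
  App-preserves-Can _             _  app0       = can0
  App-preserves-Can _             cN (appNil _) = cN
  App-preserves-Can (ccons cN₁ cT) cN (appCons p d dA) =
    App-preserves-Can cT (Sub-preserves-Can (Can-ƛ-body p cN) cN₁ d) dA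

mainTheorem2 : (k : ℕ) (M N : Tm) (x : Var) (τ : Ty) (M' : Tm) →
    Can k M → Can k N → Sub τ k N x M M' → Can k M'
mainTheorem2 k M N x τ M' = Sub-preserves-Can
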